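{- Let $T$ be a tree with $|E(T)|\ge 3$, let $B=\{v\in V(T): d_T(v)<\Delta(T)\}$, let $v\in B$, and let $H$ be a $(\Delta(T)-1)$-edge-colorable subgraph of $T$ with $V(T)\setminus V(H)=\{v\}$ (so $H$ does not cover $v$ but covers every other vertex). Then there is a spanning $\Delta(T)$-edge-colorable subgraph $H'$ of $T$ such that $d_{H'}(v)=1$.
   Context: $\Delta(T)$ is the maximum degree of $T$. A graph is $k$-edge-colorable if its edge set can be partitioned into $k$ matchings. $V(H)$ denotes the set of vertices of $T$ of degree at least $1$ in $H$. A subgraph is spanning if every vertex of $T$ has degree at least $1$ in it. -}

module Defs where

open import Data.Nat using (ℕ; zero; suc; _+_; _≤_; _<_; _⊔_; _∸_)
open import Data.Bool using (Bool; true; false; if_then_else_)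
open import Data.Fin using (Fin; toℕ)
open import Data.List using (List; []; _∷_; _++_; [_]; length; map; foldr; allFin; concatMap; filterᵇ)
open import Data.Nat.ListAction using (sum)
open import Data.List.Relation.Unary.Linked using (Linked)
open import Data.List.Relation.Unary.Unique.Propositional using (Unique)
open import Data.Nat using (_<ᵇ_)
open import Data.Product using (Σ; ∃; _×_; _,_)
open import Relation.Binary.PropositionalEquality using (_≡_; _≢_)
open import Relation.Nullary using (¬_)

record Graph (n : ℕ) : Set where
  field
    adj    : Fin n → Fin n → Bool
    sym    : ∀ u v → adj u v ≡ adj v u
    irrefl : ∀ u → adj u u ≡ false
open Graph public

Adj : ∀ {n} → Graph n → Fin n → Fin n → Set
Adj G u v = adj G u v ≡ true

deg : ∀ {n} → Graph n → Fin n → ℕ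
deg {n} G v = sum (map (λ u → if adj G v u then 1 else 0) (allFin n))

maxDeg : ∀ {n} → Graph n → ℕ
maxDeg {n} G = foldr _⊔_ 0 (map (deg G) (allFin n))

edgeCount : ∀ {n} → Graph n → ℕ
edgeCount {n} G =
  length (concatMap (λ u → filterᵇ (λ v → if toℕ u <ᵇ toℕ v then adj G u v else false) (allFin n)) (allFin n))

data Walk {n} (G : Graph n) : Fin n → Fin n → Set where
  here : ∀ {u} → Walk G u u
  step : ∀ {u v w} → Adj G u v → Walk G v w → Walk G u w

Connected : ∀ {n} → Graph n → Set
Connected {n} G = ∀ (u v : Fin n) → Walk G u v

IsCycle : ∀ {n} → Graph n → Fin n → List (Fin n) → Set
IsCycle G x ys = Unique (x ∷ ys) × (2 ≤ length ys) × Linked (Adj G) (x ∷ ys ++ [ x ])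

Acyclic : ∀ {n} → Graph n → Set
Acyclic {n} G = ∀ (x : Fin n) (ys : List (Fin n)) → ¬ IsCycle G x ys

IsTree : ∀ {n} → Graph n → Set
IsTree G = Connected G × Acyclic G

_⊆G_ : ∀ {n} → Graph n → Graph n → Set
H ⊆G T = ∀ u v → Adj H u v → Adj T u v

EdgeColorable : ∀ {n} → ℕ → Graph n → Set
EdgeColorable {n} k G =
  Σ (Fin n → Fin n → Fin k) λ c →
    (∀ u v → Adj G u v → c u v ≡ c v u) ×
    (∀ u v w → Adj G u v → Adj G u w → v ≢ w → c u v ≢ c u w)

-- V(H): vertices of degree at least 1 in H
InV : ∀ {n} → Graph n → Fin n → Set
InV H u = 1 ≤ deg H u

Spanning : ∀ {n} → Graph n → Set
Spanning {n} H = ∀ (u : Fin n) → InV H u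

module Submission where

-- Since d_T(v) < Δ, some vertex of T has
-- positive degree, so T has an edge; as T is connected, v then has a
-- neighbour u in T.  Form H′ from H by attaching the single edge vu
-- (v is isolated in H).  Every vertex other than v keeps its H-neighbours,
-- v is covered by vu, and d_{H′}(v) = 1.  A (Δ-1)-edge-colouring of H
-- extends to a Δ-edge-colouring of H′ by giving vu the new colour: no other
-- edge of H′ meets v, and the new colour is unused at u.
--
-- The
-- main theorem combines these.

open import Defs
open import Data.Nat using (ℕ; _≤_; _<_; _∸_; zero; suc; _⊔_; z≤n; s≤s)
open import Data.Nat.Properties using (≤-trans; m≤m+n; m≤n+m)
open import Data.Nat.ListAction using (sum)
open import Data.Fin using (Fin; fromℕ; inject₁) renaming (zero to fzero; suc to fsuc)
open import Data.Fin.Properties using (_≟_; fromℕ≢inject₁; inject₁-injective)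
open import Data.Bool using (Bool; true; false; if_then_else_)
open import Data.List using (List; []; _∷_; map; foldr; allFin; tabulate)
open import Data.List.Properties using (map-tabulate; map-cong)
open import Data.List.Membership.Propositional using (_∈_)
open import Data.List.Membership.Propositional.Properties using (∈-allFin)
open import Data.List.Relation.Unary.Any using (here; there)
open import Data.Product using (Σ; ∃; _×_; _,_; proj₁; proj₂)
open import Data.Empty using (⊥-elim)
open import Function using (id)
open import Relation.Binary.PropositionalEquality
  using (_≡_; _≢_; refl; trans; cong; subst; module ≡-Reasoning)
  renaming (sym to ≡-sym)
open import Relation.Nullary using (¬_; Dec; yes; no; does)
open import Relation.Nullary.Decidable using (dec-true)

indicator : Bool → ℕ
indicator b = if b then 1 else 0

indicatorSum-pos⇒witness : ∀ {A : Set} (p : A → Bool) (xs : List A) →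
  1 ≤ sum (map (λ x → indicator (p x)) xs) → ∃ λ x → p x ≡ true
indicatorSum-pos⇒witness p [] ()
indicatorSum-pos⇒witness p (x ∷ xs) pos with p x in px
... | true  = x , px
... | false = indicatorSum-pos⇒witness p xs pos

witness⇒indicatorSum-pos : ∀ {A : Set} (p : A → Bool) {x : A} {xs : List A} →
  x ∈ xs → p x ≡ true → 1 ≤ sum (map (λ y → indicator (p y)) xs)
witness⇒indicatorSum-pos p {xs = y ∷ ys} (here refl) px rewrite px = m≤m+n 1 _
witness⇒indicatorSum-pos p {xs = y ∷ ys} (there x∈ys) px =
  ≤-trans (witness⇒indicatorSum-pos p x∈ys px) (m≤n+m _ _)

indicatorSum-singleton : ∀ {n} (u : Fin n) →
  sum (map (λ x → indicator (does (x ≟ u))) (allFin n)) ≡ 1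
indicatorSum-singleton {n} u =
  trans (cong sum (map-tabulate id (λ x → indicator (does (x ≟ u))))) (counts u)
  where
  sum-zeros : ∀ m → sum (tabulate {n = m} (λ _ → 0)) ≡ 0
  sum-zeros zero    = refl
  sum-zeros (suc m) = sum-zeros m

  counts : ∀ {m} (w : Fin m) → sum (tabulate (λ x → indicator (does (x ≟ w)))) ≡ 1
  counts {suc m} fzero = cong suc (sum-zeros m)
  counts (fsuc w)      = counts w

InV⇒neighbour : ∀ {n} (G : Graph n) {a : Fin n} → InV G a → ∃ (Adj G a)
InV⇒neighbour {n} G {a} = indicatorSum-pos⇒witness (adj G a) (allFin n)

neighbour⇒InV : ∀ {n} (G : Graph n) {a x : Fin n} → Adj G a x → InV G a
neighbour⇒InV G {a} {x} = witness⇒indicatorSum-pos (adj G a) (∈-allFin x)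

Adj⇒≢ : ∀ {n} (G : Graph n) {a b : Fin n} → Adj G a b → a ≢ b
Adj⇒≢ G {a} ab refl with trans (≡-sym ab) (irrefl G a)
... | ()

maximum-pos⇒entry-pos : ∀ {A : Set} (g : A → ℕ) (xs : List A) →
  1 ≤ foldr _⊔_ 0 (map g xs) → ∃ λ x → 1 ≤ g x
maximum-pos⇒entry-pos g [] ()
maximum-pos⇒entry-pos g (x ∷ xs) pos with g x in gx
... | zero  = maximum-pos⇒entry-pos g xs pos
... | suc _ = x , subst (1 ≤_) (≡-sym gx) (s≤s z≤n)

maxDeg-pos⇒edge : ∀ {n} (G : Graph n) → 1 ≤ maxDeg G → ∃ λ w → ∃ (Adj G w)
maxDeg-pos⇒edge {n} G pos with maximum-pos⇒entry-pos (deg G) (allFin n) pos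
... | w , w∈V = w , InV⇒neighbour G w∈V

walk⇒first-neighbour : ∀ {n} {G : Graph n} {v z : Fin n} →
  Walk G v z → z ≢ v → ∃ (Adj G v)
walk⇒first-neighbour here          z≢v = ⊥-elim (z≢v refl)
walk⇒first-neighbour (step vx _) _    = _ , vx

-- In a connected graph with at least one edge every vertex has a neighbour:
-- one endpoint of the edge differs from v, and a walk to it leaves v.
connected⇒neighbour : ∀ {n} (G : Graph n) → Connected G →
  ∀ {w y : Fin n} → Adj G w y → (v : Fin n) → ∃ (Adj G v)
connected⇒neighbour G conn {w} {y} wy v with w ≟ v
... | no w≢v  = walk⇒first-neighbour (conn v w) w≢v
... | yes w≡v = walk⇒first-neighbour (conn v y) (λ y≡v → Adj⇒≢ G wy (trans w≡v (≡-sym y≡v)))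

-- Positive naturals are successors: suc (m ∸ 1) = m; used to read Δ as (Δ-1)+1.
suc-∸1 : ∀ {m} → 1 ≤ m → suc (m ∸ 1) ≡ m
suc-∸1 (s≤s _) = refl

≟-true⇒≡ : ∀ {n} {x y : Fin n} → does (x ≟ y) ≡ true → x ≡ y
≟-true⇒≡ {x = x} {y} eq with x ≟ y | eq
... | yes x≡y | _  = x≡y
... | no _    | ()

-- `attach H v u`: the graph H with every edge at v removed and the single
-- edge vu added (u ≢ v).  When v is isolated in H this just adds vu.
module Attach {n : ℕ} (H : Graph n) (v u : Fin n) (u≢v : u ≢ v) where

  attachAdj : Fin n → Fin n → Bool
  attachAdj a b =
    if does (a ≟ v) then does (b ≟ u)
    else if does (b ≟ v) then does (a ≟ u)
    else adj H a b

  attachAdj-sym : ∀ a b → attachAdj a b ≡ attachAdj b a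
  attachAdj-sym a b with a ≟ v | b ≟ v
  ... | yes refl | yes refl = refl
  ... | yes _    | no _     = refl
  ... | no _     | yes _    = refl
  ... | no _     | no _     = Graph.sym H a b

  attachAdj-irrefl : ∀ a → attachAdj a a ≡ false
  attachAdj-irrefl a with a ≟ v
  ... | no _     = irrefl H a
  ... | yes refl with v ≟ u
  ...   | yes v≡u = ⊥-elim (u≢v (≡-sym v≡u))
  ...   | no _    = refl

  attach : Graph n
  attach = record { adj = attachAdj ; sym = attachAdj-sym ; irrefl = attachAdj-irrefl }

  attachAdj-at-v : ∀ b → attachAdj v b ≡ does (b ≟ u)
  attachAdj-at-v b with v ≟ v
  ... | yes _   = refl
  ... | no v≢v  = ⊥-elim (v≢v refl)

  attach-deg-v : deg attach v ≡ 1
  attach-deg-v = begin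
    sum (map (λ b → indicator (attachAdj v b)) (allFin n))
      ≡⟨ cong sum (map-cong (λ b → cong indicator (attachAdj-at-v b)) (allFin n)) ⟩
    sum (map (λ b → indicator (does (b ≟ u))) (allFin n))
      ≡⟨ indicatorSum-singleton u ⟩
    1 ∎
    where open ≡-Reasoning

  attach-⊆ : (T : Graph n) → H ⊆G T → Adj T v u → attach ⊆G T
  attach-⊆ T H⊆T vu a b ab with a ≟ v | b ≟ v
  ... | yes refl | _        = subst (Adj T v) (≡-sym (≟-true⇒≡ ab)) vu
  ... | no _     | yes refl = trans (Graph.sym T a v) (subst (Adj T v) (≡-sym (≟-true⇒≡ ab)) vu)
  ... | no _     | no _     = H⊆T a b ab

  attach-v-u : Adj attach v u
  attach-v-u = trans (attachAdj-at-v u) (dec-true (u ≟ u) refl)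

  attach-keeps : ∀ {a b} → a ≢ v → b ≢ v → Adj H a b → Adj attach a b
  attach-keeps {a} {b} a≢v b≢v ab with a ≟ v | b ≟ v
  ... | yes a≡v | _       = ⊥-elim (a≢v a≡v)
  ... | no _    | yes b≡v = ⊥-elim (b≢v b≡v)
  ... | no _    | no _    = ab

  attach-spanning : ¬ InV H v → (∀ a → a ≢ v → InV H a) → Spanning attach
  attach-spanning v∉H covers a = coveredBy (a ≟ v)
    where
    coveredBy : Dec (a ≡ v) → InV attach a
    coveredBy (yes a≡v) = subst (InV attach) (≡-sym a≡v) (neighbour⇒InV attach {v} attach-v-u)
    coveredBy (no a≢v) with InV⇒neighbour H (covers a a≢v)
    ... | x , ax = neighbour⇒InV attach {a} (attach-keeps a≢v x≢v ax)
      where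
      x≢v : x ≢ v
      x≢v refl = v∉H (neighbour⇒InV H (trans (Graph.sym H v a) ax))

  module Colouring {k : ℕ} (c : Fin n → Fin n → Fin k) where

    colour : Fin n → Fin n → Fin (suc k)
    colour a b =
      if does (a ≟ v) then fromℕ k
      else if does (b ≟ v) then fromℕ k
      else inject₁ (c a b)

    colour-sym : (∀ a b → Adj H a b → c a b ≡ c b a) →
      ∀ a b → Adj attach a b → colour a b ≡ colour b a
    colour-sym c-sym a b ab with a ≟ v | b ≟ v
    ... | yes _ | yes _ = refl
    ... | yes _ | no _  = refl
    ... | no _  | yes _ = refl
    ... | no _  | no _  = cong inject₁ (c-sym a b ab)

    colour-proper : (∀ a b d → Adj H a b → Adj H a d → b ≢ d → c a b ≢ c a d) →
      ∀ a b d → Adj attach a b → Adj attach a d → b ≢ d → colour a b ≢ colour a d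
    colour-proper c-proper a b d ab ad b≢d with a ≟ v
    ... | yes _ = λ _ → b≢d (trans (≟-true⇒≡ ab) (≡-sym (≟-true⇒≡ ad)))
    ... | no _ with b ≟ v | d ≟ v
    ...   | yes b≡v | yes d≡v = λ _ → b≢d (trans b≡v (≡-sym d≡v))
    ...   | yes _   | no _    = fromℕ≢inject₁
    ...   | no _    | yes _   = λ eq → fromℕ≢inject₁ (≡-sym eq)
    ...   | no _    | no _    = λ eq → c-proper a b d ab ad b≢d (inject₁-injective eq)

  attach-colorable : ∀ {k} → EdgeColorable k H → EdgeColorable (suc k) attach
  attach-colorable (c , c-sym , c-proper) =
    colour , colour-sym c-sym , colour-proper c-proper
    where open Colouring c

mainTheorem8 : (n : ℕ) (T : Graph n) → IsTree T → 3 ≤ edgeCount T →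
    (v : Fin n) → deg T v < maxDeg T →
    (H : Graph n) → H ⊆G T → EdgeColorable (maxDeg T ∸ 1) H →
    ¬ InV H v → (∀ (u : Fin n) → u ≢ v → InV H u) →
    Σ (Graph n) λ H′ → H′ ⊆G T × Spanning H′ × EdgeColorable (maxDeg T) H′ × deg H′ v ≡ 1
mainTheorem8 n T (connected , _) _ v dv<Δ H H⊆T H-colorable v∉H covers =
  attach , attach-⊆ T H⊆T vu , attach-spanning v∉H covers ,
  subst (λ k → EdgeColorable k attach) (suc-∸1 Δ-pos) (attach-colorable H-colorable) ,
  attach-deg-v
  where
  Δ-pos : 1 ≤ maxDeg T
  Δ-pos = ≤-trans (s≤s z≤n) dv<Δ

  neighbour : ∃ (Adj T v)
  neighbour = let (_ , _ , wy) = maxDeg-pos⇒edge T Δ-pos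
              in connected⇒neighbour T connected wy v

  u : Fin n
  u = proj₁ neighbour

  vu : Adj T v u
  vu = proj₂ neighbour

  open Attach H v u (λ u≡v → Adj⇒≢ T vu (≡-sym u≡v))
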